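{- Let $m,n>0$. An $m$-Dyck path $\mathfrak{p}\in D_n^{(m)}$ is meet-irreducible in $\mathcal{T}_n^{(m)}$ if and only if its step sequence $(u_{1},\ldots,u_{n})$ satisfies $u_j=0$ for $j\leq i$ and $u_j=a$ for $j>i$, for some $i\in\{1,2,\dots,n-1\}$ and some $a\in\{1,2,\ldots,mi\}$.
   Context: An $m$-Dyck path of length $(m+1)n$ is a lattice path from $(0,0)$ to $(mn,n)$ with north-steps and east-steps staying weakly above the line $x=my$; $D_n^{(m)}$ is their set. Its step sequence $(u_1,\dots,u_n)$ records the $x$-coordinate $u_k$ of the $k$-th north-step (so $u_1\le\cdots\le u_n$, $u_k\le m(k-1)$). The primitive subsequence at position $i$ is $(u_i,\dots,u_k)$ with $k\ge i$ the largest index such that $u_j-u_i<m(j-i)$ for all $i<j\le k$. Set $\mathfrak p\lessdot_{\mathrm{rot}}\mathfrak p'$ if the step sequence of $\mathfrak p'$ is obtained from that of $\mathfrak p$ by decreasing each entry of the primitive subsequence at some position $i\in\{2,\dots,n\}$ with $u_{i-1}<u_i$ by $1$. The rotation order $\le_{\mathrm{rot}}$ is its reflexive transitive closure, and $\mathcal T_n^{(m)}=(D_n^{(m)},\le_{\mathrm{rot}})$. An element is meet-irreducible if it is not maximal and has exactly one upper cover. -}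

module Defs where

open import Data.Nat using (ℕ; zero; suc; _+_; _*_; _∸_; _≤_; _<_)
open import Data.Fin using (Fin; toℕ)
open import Data.Fin.Base using () renaming (_≤_ to _≤ᶠ_; _<_ to _<ᶠ_)
open import Data.Vec using (Vec; lookup)
open import Data.Product using (Σ; ∃; ∃-syntax; _×_; proj₁)
open import Relation.Nullary using (¬_)
open import Relation.Binary.PropositionalEquality using (_≡_; _≢_)
open import Relation.Binary.Construct.Closure.ReflexiveTransitive using (Star)

-- Step sequences are vectors u of length n; index k : Fin n (0-based) stands
-- for the paper's index k+1, so u_{k+1} = lookup u k.

IsDyck : (m n : ℕ) → Vec ℕ n → Set
IsDyck m n u =
  (∀ (i j : Fin n) → i ≤ᶠ j → lookup u i ≤ lookup u j) ×
  (∀ (k : Fin n) → lookup u k ≤ m * toℕ k)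

Dyck : (m n : ℕ) → Set
Dyck m n = Σ (Vec ℕ n) (IsDyck m n)

-- j belongs to the primitive subsequence at position i:
-- i ≤ j and for all l with i < l ≤ j, u_l - u_i < m (l - i)
-- (written additively to avoid truncated subtraction; u_l ≥ u_i anyway).
InPrim : (m : ℕ) {n : ℕ} → Vec ℕ n → Fin n → Fin n → Set
InPrim m u i j =
  i ≤ᶠ j ×
  (∀ l → i <ᶠ l → l ≤ᶠ j → lookup u l < lookup u i + m * (toℕ l ∸ toℕ i))

RotAt : (m : ℕ) {n : ℕ} → Vec ℕ n → Vec ℕ n → Fin n → Set
RotAt m {n} u u' i =
  (Σ (Fin n) λ h → suc (toℕ h) ≡ toℕ i × lookup u h < lookup u i) ×
  (∀ j → (InPrim m u i j → lookup u' j ≡ lookup u j ∸ 1) ×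
         (¬ InPrim m u i j → lookup u' j ≡ lookup u j))

Rot⋖ : (m n : ℕ) → Dyck m n → Dyck m n → Set
Rot⋖ m n p p' = ∃[ i ] RotAt m (proj₁ p) (proj₁ p') i

RotLe : (m n : ℕ) → Dyck m n → Dyck m n → Set
RotLe m n = Star (Rot⋖ m n)

-- paths are identified by their step sequences
RotLt : (m n : ℕ) → Dyck m n → Dyck m n → Set
RotLt m n p q = RotLe m n p q × proj₁ p ≢ proj₁ q

Covers : (m n : ℕ) → Dyck m n → Dyck m n → Set
Covers m n p q = RotLt m n p q × (∀ z → ¬ (RotLt m n p z × RotLt m n z q))

IsMaximal : (m n : ℕ) → Dyck m n → Set
IsMaximal m n p = ∀ q → ¬ (RotLt m n p q)

MeetIrreducible : (m n : ℕ) → Dyck m n → Set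
MeetIrreducible m n p =
  ¬ IsMaximal m n p ×
  (∃[ q ] (Covers m n p q × (∀ q' → Covers m n p q' → proj₁ q' ≡ proj₁ q)))

-- u_j = 0 for j ≤ i and u_j = a for j > i (1-based j), i.e. for
-- 0-based k: u = 0 if k < i, else a.
IsTwoValued : {n : ℕ} → Vec ℕ n → ℕ → ℕ → Set
IsTwoValued u i a = ∀ k → (toℕ k < i → lookup u k ≡ 0) × (i ≤ toℕ k → lookup u k ≡ a)

-- Call k an ascent of a step sequence u if u_{k-1} < u_k; the rotations out of p
-- are exactly those at its ascents, and the sum of the step sequence drops along
-- each of them. Both sides of the equivalence say that p has a single ascent:
-- for an m-Dyck sequence this is the two-valued shape, and a single ascent s
-- gives p a single successor rot_s(p), which is then its unique upper cover.
-- Conversely, let rot_s(p) be the unique upper cover. Each rotation rot_t(p)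
-- lies above an upper cover of p, hence above rot_s(p); as rot_t(p) keeps u_s
-- unless s is in the primitive subsequence at t, this forces t ≤ s. If there
-- were an ascent t < s, take the last one: the first rotation out of rot_s(p)
-- lowers an entry that rot_s(p) shares with rot_t(p), so rot_s(p) ≤ rot_t(p)
-- fails.
module Submission where

open import Defs
open import Data.Nat using (ℕ; _*_; _≤_; _<_)
open import Data.Product using (∃-syntax; _×_; proj₁)
open import Function.Bundles using (_⇔_)

open import Data.Bool using (if_then_else_)
open import Data.Empty using (⊥-elim)
open import Data.Fin using (Fin; toℕ; fromℕ<; inject₁) renaming (zero to fzero; suc to fsuc)
open import Data.Fin.Base using () renaming (_≤_ to _≤ᶠ_)
open import Data.Fin.Properties using (toℕ-injective; toℕ-fromℕ<; toℕ-inject₁; toℕ<n; any?; all?)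
open import Data.Nat using (zero; suc; _+_; _∸_; pred; z≤n; s≤s; s≤s⁻¹; _≟_; _≤?_; _<?_)
open import Data.Nat.Properties
open import Data.Product using (Σ-syntax; _,_; proj₂)
open import Data.Vec using (Vec; []; _∷_; lookup; tabulate; sum)
open import Data.Vec.Properties using (lookup∘tabulate; tabulate∘lookup; tabulate-cong; ≡-dec)
open import Function using (_∘_)
open import Function.Bundles using (mk⇔)
open import Relation.Binary using (tri<; tri≈; tri>)
open import Relation.Binary.Construct.Closure.ReflexiveTransitive using (ε; _◅_; _◅◅_)
open import Relation.Binary.PropositionalEquality
  using (_≡_; _≢_; refl; sym; trans; cong; subst; subst₂)
open import Relation.Nullary using (¬_; Dec; yes; no; does)
open import Relation.Nullary.Decidable using (_×-dec_; _→-dec_; decidable-stable; dec-true; dec-false)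
open import Relation.Nullary.Negation using (¬¬-map)
open import Relation.Unary using (Decidable)

pred-< : ∀ {x} → 0 < x → pred x < x
pred-< {suc x} _ = ≤-refl

*-pos : ∀ {a b} → 0 < a → 0 < b → 0 < a * b
*-pos {suc a} {suc b} _ _ = s≤s z≤n

lookup-ext : ∀ {a} {A : Set a} {n} {u v : Vec A n} → (∀ k → lookup u k ≡ lookup v k) → u ≡ v
lookup-ext {u = u} {v} u≗v =
  trans (sym (tabulate∘lookup u)) (trans (tabulate-cong u≗v) (tabulate∘lookup v))

sum-mono-≤ : ∀ {n} {u v : Vec ℕ n} → (∀ k → lookup u k ≤ lookup v k) → sum u ≤ sum v
sum-mono-≤ {u = []}    {[]}    _   = z≤n
sum-mono-≤ {u = _ ∷ u} {_ ∷ v} u≤v = +-mono-≤ (u≤v fzero) (sum-mono-≤ {u = u} {v} (u≤v ∘ fsuc))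

sum-mono-< : ∀ {n} {u v : Vec ℕ n} → (∀ k → lookup u k ≤ lookup v k) →
             ∀ k → lookup u k < lookup v k → sum u < sum v
sum-mono-< {u = _ ∷ u} {_ ∷ v} u≤v fzero    u<v = +-mono-<-≤ u<v (sum-mono-≤ {u = u} {v} (u≤v ∘ fsuc))
sum-mono-< {u = _ ∷ u} {_ ∷ v} u≤v (fsuc k) u<v =
  +-mono-≤-< (u≤v fzero) (sum-mono-< {u = u} {v} (u≤v ∘ fsuc) k u<v)

predecessor : ∀ {n} (k : Fin n) → 0 < toℕ k → Σ[ h ∈ Fin n ] suc (toℕ h) ≡ toℕ k
predecessor (fsuc h) _ = inject₁ h , cong suc (toℕ-inject₁ h)

greatest-below : ∀ {p n} {P : Fin n → Set p} → Decidable P → ∀ s {t} → toℕ t < s → P t →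
                 Σ[ k ∈ Fin n ] (toℕ k < s × P k × (∀ l → toℕ k < toℕ l → toℕ l < s → ¬ P l))
greatest-below {n = n} {P} P? s {t} t<s Pt = search s (m≤n+m s (toℕ t)) t<s Pt
  where
  search : ∀ N {t} → s ≤ toℕ t + N → toℕ t < s → P t →
           Σ[ k ∈ Fin n ] (toℕ k < s × P k × (∀ l → toℕ k < toℕ l → toℕ l < s → ¬ P l))
  search zero    s≤t t<s _ = ⊥-elim (<⇒≱ t<s (subst (s ≤_) (+-identityʳ _) s≤t))
  search (suc N) {t} s≤t+N t<s Pt with any? (λ l → (toℕ t <? toℕ l) ×-dec (toℕ l <? s) ×-dec P? l)
  ... | yes (l , t<l , l<s , Pl) =
    search N (≤-trans s≤t+N (subst (_≤ toℕ l + N) (sym (+-suc (toℕ t) N)) (+-monoˡ-≤ N t<l))) l<s Pl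
  ... | no none = t , t<s , Pt , λ l t<l l<s Pl → none (l , t<l , l<s , Pl)

module _ (m : ℕ) {n : ℕ} where

  private variable
    u v w x : Vec ℕ n
    i j k : Fin n
    p q r c : Dyck m n

  Monotone : Vec ℕ n → Set
  Monotone u = ∀ i j → i ≤ᶠ j → lookup u i ≤ lookup u j

  Ascent : Vec ℕ n → Fin n → Set
  Ascent u k = Σ[ h ∈ Fin n ] suc (toℕ h) ≡ toℕ k × lookup u h < lookup u k

  UniqueAscent : Vec ℕ n → Set
  UniqueAscent u = Σ[ s ∈ Fin n ] Ascent u s × (∀ t → Ascent u t → t ≡ s)

  ascent? : ∀ (u : Vec ℕ n) → Decidable (Ascent u)
  ascent? u k = any? {n = n} (λ h → (suc (toℕ h) ≟ toℕ k) ×-dec (lookup u h <? lookup u k))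

  inPrim? : ∀ (u : Vec ℕ n) i j → Dec (InPrim m u i j)
  inPrim? u i j = (toℕ i ≤? toℕ j) ×-dec
    all? {n = n} (λ l → (toℕ i <? toℕ l) →-dec ((toℕ l ≤? toℕ j) →-dec
                (lookup u l <? lookup u i + m * (toℕ l ∸ toℕ i))))

  inPrim-refl : ∀ (u : Vec ℕ n) i → InPrim m u i i
  inPrim-refl u i = ≤-refl , λ l i<l l≤i → ⊥-elim (<⇒≱ i<l l≤i)

  inPrim-prefix : ∀ {l} → InPrim m u i j → toℕ i ≤ toℕ l → toℕ l ≤ toℕ j → InPrim m u i l
  inPrim-prefix (_ , below) i≤l l≤j = i≤l , λ l′ i<l′ l′≤l → below l′ i<l′ (≤-trans l′≤l l≤j)

  flat⇒inPrim : 0 < m → toℕ i ≤ toℕ j →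
                (∀ l → toℕ i < toℕ l → toℕ l ≤ toℕ j → lookup u l ≡ lookup u i) → InPrim m u i j
  flat⇒inPrim {i = i} {u = u} m>0 i≤j flat = i≤j , λ l i<l l≤j →
    subst (_< lookup u i + m * (toℕ l ∸ toℕ i)) (sym (flat l i<l l≤j))
          (m<m+n (lookup u i) (*-pos m>0 (m<n⇒0<n∸m i<l)))

  noAscent⇒flat : Monotone u → toℕ i ≤ toℕ j →
                  (∀ k → toℕ i < toℕ k → toℕ k ≤ toℕ j → ¬ Ascent u k) → lookup u j ≡ lookup u i
  noAscent⇒flat {u = u} {i = i} {j = j} mono i≤j =
    descend (toℕ j ∸ toℕ i) (sym (m+[n∸m]≡n i≤j))
    where
    i< : ∀ {d j} → toℕ j ≡ toℕ i + suc d → toℕ i < toℕ j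
    i< j≡i+d+1 = subst (toℕ i <_) (sym j≡i+d+1) (m<m+n (toℕ i) (s≤s z≤n))
    descend : ∀ d {j} → toℕ j ≡ toℕ i + d →
              (∀ k → toℕ i < toℕ k → toℕ k ≤ toℕ j → ¬ Ascent u k) → lookup u j ≡ lookup u i
    descend zero    j≡i _ = cong (lookup u) (toℕ-injective (trans j≡i (+-identityʳ _)))
    descend (suc d) {j} j≡i+d+1 none with predecessor j (≤-<-trans z≤n (i< j≡i+d+1))
    ... | h , h+1≡j = trans u[j]≡u[h] (descend d h≡i+d (λ k i<k k≤h → none k i<k (≤-trans k≤h h≤j)))
      where
      h≡i+d : toℕ h ≡ toℕ i + d
      h≡i+d = suc-injective (trans h+1≡j (trans j≡i+d+1 (+-suc _ d)))
      h≤j : toℕ h ≤ toℕ j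
      h≤j = subst (toℕ h ≤_) h+1≡j (n≤1+n _)
      u[j]≡u[h] : lookup u j ≡ lookup u h
      u[j]≡u[h] = ≤-antisym (≮⇒≥ (λ u[h]<u[j] → none j (i< j≡i+d+1) ≤-refl (h , h+1≡j , u[h]<u[j])))
                            (mono h j h≤j)

  -- RotAt unfolds to a Σ-type, from which Agda cannot infer the vectors and the
  -- position; wrapping it in a record makes them inferable.
  record Rotation (u : Vec ℕ n) (i : Fin n) (v : Vec ℕ n) : Set where
    constructor rotation
    field rotAt : RotAt m u v i

  open Rotation

  rotation-ascent : Rotation u i v → Ascent u i
  rotation-ascent ρ = proj₁ (rotAt ρ)

  rotation-inPrim : Rotation u i v → InPrim m u i j → lookup v j ≡ lookup u j ∸ 1
  rotation-inPrim {j = j} ρ = proj₁ (proj₂ (rotAt ρ) j)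

  rotation-outside : Rotation u i v → ¬ InPrim m u i j → lookup v j ≡ lookup u j
  rotation-outside {j = j} ρ = proj₂ (proj₂ (rotAt ρ) j)

  rotation-before : Rotation u i v → toℕ j < toℕ i → lookup v j ≡ lookup u j
  rotation-before ρ j<i = rotation-outside ρ (λ j∈prim → <⇒≱ j<i (proj₁ j∈prim))

  rotation-pos : Rotation u i v → 0 < lookup u i
  rotation-pos ρ with rotation-ascent ρ
  ... | _ , _ , u[h]<u[i] = ≤-<-trans z≤n u[h]<u[i]

  rotation-≤ : Rotation u i v → ∀ j → lookup v j ≤ lookup u j
  rotation-≤ {u = u} {i = i} ρ j with inPrim? u i j
  ... | yes j∈prim = ≤-trans (≤-reflexive (rotation-inPrim ρ j∈prim)) pred[n]≤n
  ... | no  j∉prim = ≤-reflexive (rotation-outside ρ j∉prim)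

  rotation-< : Rotation u i v → lookup v i < lookup u i
  rotation-< {u = u} {i = i} ρ =
    ≤-<-trans (≤-reflexive (rotation-inPrim ρ (inPrim-refl u i))) (pred-< (rotation-pos ρ))

  rotation-functional : Rotation u i v → Rotation u i w → v ≡ w
  rotation-functional {u = u} {i = i} ρ σ = lookup-ext agree
    where
    agree : ∀ j → _
    agree j with inPrim? u i j
    ... | yes j∈prim = trans (rotation-inPrim ρ j∈prim) (sym (rotation-inPrim σ j∈prim))
    ... | no  j∉prim = trans (rotation-outside ρ j∉prim) (sym (rotation-outside σ j∉prim))

  rotation-monotone : Monotone u → Rotation u i v → Monotone v
  rotation-monotone {u = u} {i = i} mono ρ x y x≤y with inPrim? u i x | inPrim? u i y
  ... | yes x∈prim | yes y∈prim =
    subst₂ _≤_ (sym (rotation-inPrim ρ x∈prim)) (sym (rotation-inPrim ρ y∈prim)) (pred-mono-≤ (mono x y x≤y))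
  ... | yes x∈prim | no  y∉prim =
    subst₂ _≤_ (sym (rotation-inPrim ρ x∈prim)) (sym (rotation-outside ρ y∉prim)) (≤-trans pred[n]≤n (mono x y x≤y))
  ... | no  x∉prim | no  y∉prim =
    subst₂ _≤_ (sym (rotation-outside ρ x∉prim)) (sym (rotation-outside ρ y∉prim)) (mono x y x≤y)
  ... | no  x∉prim | yes y∈prim =
    subst₂ _≤_ (sym (rotation-outside ρ x∉prim)) (sym (rotation-inPrim ρ y∈prim)) (<⇒≤pred u[x]<u[y])
    where
    x<i : toℕ x < toℕ i
    x<i = ≰⇒> (λ i≤x → x∉prim (inPrim-prefix {u = u} y∈prim i≤x x≤y))
    u[x]<u[y] : lookup u x < lookup u y
    u[x]<u[y] with rotation-ascent ρ
    ... | h , h+1≡i , u[h]<u[i] =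
      ≤-<-trans (mono x h (s≤s⁻¹ (subst (toℕ x <_) (sym h+1≡i) x<i)))
                (<-≤-trans u[h]<u[i] (mono i y (proj₁ y∈prim)))

  rotation-isDyck : IsDyck m n u → Rotation u i v → IsDyck m n v
  rotation-isDyck (mono , bounded) ρ =
    rotation-monotone mono ρ , λ k → ≤-trans (rotation-≤ ρ k) (bounded k)

  rotate : Vec ℕ n → Fin n → Vec ℕ n
  rotate u i = tabulate λ j → if does (inPrim? u i j) then lookup u j ∸ 1 else lookup u j

  rotate-rotation : ∀ {u} → Ascent u i → Rotation u i (rotate u i)
  rotate-rotation {i = i} {u} i-ascent = rotation (i-ascent , λ j →
    (λ j∈prim → trans (lookup∘tabulate _ j) (cong (if_then _ else _) (dec-true (inPrim? u i j) j∈prim))) ,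
    (λ j∉prim → trans (lookup∘tabulate _ j) (cong (if_then _ else _) (dec-false (inPrim? u i j) j∉prim))))

  rotateDyck : (p : Dyck m n) → Ascent (proj₁ p) i → Dyck m n
  rotateDyck {i = i} (u , u-dyck) i-ascent =
    rotate u i , rotation-isDyck u-dyck (rotate-rotation {u = u} i-ascent)

  weight : Dyck m n → ℕ
  weight p = sum (proj₁ p)

  step-rotation : ∀ p q (p⋖q : Rot⋖ m n p q) → Rotation (proj₁ p) (proj₁ p⋖q) (proj₁ q)
  step-rotation _ _ (_ , q-rot) = rotation q-rot

  rotLe⇒≥ : RotLe m n p q → ∀ j → lookup (proj₁ q) j ≤ lookup (proj₁ p) j
  rotLe⇒≥ ε j = ≤-refl
  rotLe⇒≥ {p = p} (_◅_ {j = y} p⋖y y≤q) j = ≤-trans (rotLe⇒≥ y≤q j) (rotation-≤ (step-rotation p y p⋖y) j)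

  rotLe⇒weight-≥ : RotLe m n p q → weight q ≤ weight p
  rotLe⇒weight-≥ {p = p} {q = q} p≤q = sum-mono-≤ {u = proj₁ q} {proj₁ p} (rotLe⇒≥ p≤q)

  rotLt⇒weight-> : RotLt m n p q → weight q < weight p
  rotLt⇒weight-> (ε , p≢p) = ⊥-elim (p≢p refl)
  rotLt⇒weight-> {p = p} (_◅_ {j = y} p⋖y y≤q , _) =
    ≤-<-trans (rotLe⇒weight-≥ y≤q)
              (sum-mono-< {u = proj₁ y} {proj₁ p} (rotation-≤ ρ) (proj₁ p⋖y) (rotation-< ρ))
    where ρ = step-rotation p y p⋖y

  rot⋖⇒rotLt : Rot⋖ m n p q → RotLt m n p q
  rot⋖⇒rotLt {p = p} {q = q} p⋖q@(i , _) = p⋖q ◅ ε , λ p≡q →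
    <-irrefl (cong (λ v → lookup v i) (sym p≡q)) (rotation-< (step-rotation p q p⋖q))

  covers⇒rot⋖ : Covers m n p q → Rot⋖ m n p q
  covers⇒rot⋖ ((ε , p≢p) , _) = ⊥-elim (p≢p refl)
  covers⇒rot⋖ {p = p} {q = q} ((_◅_ {j = y} (i , y-rot) y≤q , _) , nothing-between)
    with ≡-dec _≟_ (proj₁ y) (proj₁ q)
  ... | yes y≡q = i , subst (λ v → RotAt m (proj₁ p) v i) y≡q y-rot
  ... | no  y≢q = ⊥-elim (nothing-between y (rot⋖⇒rotLt (i , y-rot) , y≤q , y≢q))

  -- Constructively the order is well-founded (the weight drops) but not decidable,
  -- so a cover below r exists only up to double negation.
  cover-below : RotLt m n p r → ¬ ¬ (Σ[ c ∈ Dyck m n ] Covers m n p c × RotLe m n c r)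
  cover-below {p = p} p<r = search (weight p) p<r (m≤n+m _ _)
    where
    search : ∀ N {r} → RotLt m n p r → weight p ≤ weight r + N →
             ¬ ¬ (Σ[ c ∈ Dyck m n ] Covers m n p c × RotLe m n c r)
    search zero    p<r w[p]≤w[r] _ =
      <⇒≱ (rotLt⇒weight-> p<r) (subst (weight p ≤_) (+-identityʳ _) w[p]≤w[r])
    search (suc N) {r} p<r w[p]≤w[r]+N+1 no-cover = no-cover (r , (p<r , nothing-between) , ε)
      where
      nothing-between : ∀ z → ¬ (RotLt m n p z × RotLt m n z r)
      nothing-between z (p<z , z<r) =
        search N p<z w[p]≤w[z]+N (λ { (c , c-covers , c≤z) → no-cover (c , c-covers , c≤z ◅◅ proj₁ z<r) })
        where
        w[p]≤w[z]+N : weight p ≤ weight z + N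
        w[p]≤w[z]+N = ≤-trans w[p]≤w[r]+N+1
          (subst (_≤ weight z + N) (sym (+-suc _ N)) (+-monoˡ-≤ N (rotLt⇒weight-> z<r)))

  uniqueAscent⇒meetIrreducible : (p : Dyck m n) → UniqueAscent (proj₁ p) → MeetIrreducible m n p
  uniqueAscent⇒meetIrreducible p@(u , _) (s , s-ascent , unique) =
    (λ maximal → maximal successor p<successor) , successor , (p<successor , nothing-between) ,
    λ q′ q′-covers → successor-unique q′ (covers⇒rot⋖ q′-covers)
    where
    successor : Dyck m n
    successor = rotateDyck p s-ascent

    p<successor : RotLt m n p successor
    p<successor = rot⋖⇒rotLt (s , rotAt (rotate-rotation {u = u} s-ascent))

    successor-unique : ∀ y → Rot⋖ m n p y → proj₁ y ≡ proj₁ successor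
    successor-unique y p⋖y@(t , _) with unique t (rotation-ascent (step-rotation p y p⋖y))
    ... | refl = rotation-functional (step-rotation p y p⋖y) (rotate-rotation s-ascent)

    nothing-between : ∀ z → ¬ (RotLt m n p z × RotLt m n z successor)
    nothing-between z ((ε , p≢p) , _) = p≢p refl
    nothing-between z ((_◅_ {j = y} p⋖y y≤z , _) , z<q) =
      <⇒≱ (rotLt⇒weight-> z<q)
          (subst (λ v → weight z ≤ sum v) (successor-unique y p⋖y) (rotLe⇒weight-≥ y≤z))

  rotation-above⇒inPrim : ∀ {s t} → Rotation u s (proj₁ c) → Rotation u t (proj₁ r) →
                          RotLe m n c r → InPrim m u t s
  rotation-above⇒inPrim {u = u} {s = s} {t = t} σ ρ c≤r with inPrim? u t s
  ... | yes s∈prim = s∈prim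
  ... | no  s∉prim = ⊥-elim (<⇒≱ (rotation-< σ) (subst (_≤ _) (rotation-outside ρ s∉prim) (rotLe⇒≥ c≤r s)))

  module _ (m>0 : 0 < m) {u : Vec ℕ n} (mono : Monotone u) {s t : Fin n}
           (no-ascent-after : ∀ k → toℕ s < toℕ k → ¬ Ascent u k)
           (t<s : toℕ t < toℕ s) (s∈prim[t] : InPrim m u t s)
           (no-ascent-between : ∀ k → toℕ t < toℕ k → toℕ k < toℕ s → ¬ Ascent u k)
           where

    rotation-after-last-ascent : Rotation u s w → ∀ j → toℕ s ≤ toℕ j → lookup w j ≡ lookup u s ∸ 1
    rotation-after-last-ascent σ j s≤j =
      trans (rotation-inPrim σ (flat⇒inPrim {u = u} m>0 s≤j (λ l s<l _ → flat l (<⇒≤ s<l))))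
            (cong (_∸ 1) (flat j s≤j))
      where
      flat : ∀ l → toℕ s ≤ toℕ l → lookup u l ≡ lookup u s
      flat l s≤l = noAscent⇒flat {u = u} mono s≤l (λ k s<k _ → no-ascent-after k s<k)

    rotations-agree-at-s : Rotation u s w → Rotation u t v → lookup w s ≡ lookup v s
    rotations-agree-at-s σ ρ =
      trans (rotation-inPrim σ (inPrim-refl u s)) (sym (rotation-inPrim ρ s∈prim[t]))

    s∈prim[t]-in-rotation : Rotation u s w → InPrim m w t s
    s∈prim[t]-in-rotation {w = w} σ = <⇒≤ t<s , λ l t<l l≤s →
      subst (λ x → lookup w l < x + m * (toℕ l ∸ toℕ t)) (sym (rotation-before σ t<s))
            (≤-<-trans (rotation-≤ σ l) (proj₂ s∈prim[t] l t<l l≤s))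

    -- The witness is j = k if k < t, and j = s if k is t or s; w has no other ascent.
    shared-entry-lowered : Rotation u s w → Rotation u t v → Monotone w → Rotation w k x →
                      Σ[ j ∈ Fin n ] InPrim m w k j × lookup w j ≤ lookup v j × 0 < lookup w j
    shared-entry-lowered {w = w} {k = k} σ ρ w-mono τ with rotation-ascent τ | <-cmp (toℕ k) (toℕ t)
    ... | _ | tri< k<t _ _ =
      k , inPrim-refl w k ,
      ≤-reflexive (trans (rotation-before σ (<-trans k<t t<s)) (sym (rotation-before ρ k<t))) ,
      rotation-pos τ
    ... | _ | tri≈ _ k≡t _ =
      s , subst (λ i → InPrim m w i s) (sym (toℕ-injective k≡t)) (s∈prim[t]-in-rotation σ) ,
      ≤-reflexive (rotations-agree-at-s σ ρ) ,
      <-≤-trans (rotation-pos τ) (w-mono k s (subst (_≤ toℕ s) (sym k≡t) (<⇒≤ t<s)))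
    ... | h , h+1≡k , w[h]<w[k] | tri> _ _ t<k with <-cmp (toℕ k) (toℕ s)
    ...   | tri< k<s _ _ = ⊥-elim (no-ascent-between k t<k k<s
                             (h , h+1≡k , subst₂ _<_ (rotation-before σ h<s) (rotation-before σ k<s) w[h]<w[k]))
      where
      h<s : toℕ h < toℕ s
      h<s = <-trans (subst (toℕ h <_) h+1≡k ≤-refl) k<s
    ...   | tri≈ _ k≡s _ =
      s , subst (λ i → InPrim m w i s) (sym (toℕ-injective k≡s)) (inPrim-refl w s) ,
      ≤-reflexive (rotations-agree-at-s σ ρ) ,
      subst (λ i → 0 < lookup w i) (toℕ-injective k≡s) (rotation-pos τ)
    ...   | tri> _ _ s<k = ⊥-elim (<-irrefl (trans (rotation-after-last-ascent σ h s≤h)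
                                              (sym (rotation-after-last-ascent σ k (<⇒≤ s<k)))) w[h]<w[k])
      where
      s≤h : toℕ s ≤ toℕ h
      s≤h = s≤s⁻¹ (subst (suc (toℕ s) ≤_) (sym h+1≡k) s<k)

    rotation-at-last-ascent-not-below : Rotation u s (proj₁ c) → Rotation u t (proj₁ r) → ¬ RotLe m n c r
    rotation-at-last-ascent-not-below σ ρ ε = <-irrefl (rotation-before σ t<s) (rotation-< ρ)
    rotation-at-last-ascent-not-below {c = c} σ ρ (_◅_ {j = z} c⋖z z≤r)
      with shared-entry-lowered σ ρ (proj₁ (proj₂ c)) (step-rotation c z c⋖z)
    ... | j , j∈prim , w[j]≤r[j] , 0<w[j] =
      n≮n _ (≤-<-trans w[j]≤r[j] (≤-<-trans (rotLe⇒≥ z≤r j)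
              (≤-<-trans (≤-reflexive (rotation-inPrim (step-rotation c z c⋖z) j∈prim)) (pred-< 0<w[j]))))

  meetIrreducible⇒uniqueAscent : 0 < m → (p : Dyck m n) → MeetIrreducible m n p → UniqueAscent (proj₁ p)
  meetIrreducible⇒uniqueAscent m>0 p@(u , mono , _) (_ , q , q-covers , q-unique)
    with covers⇒rot⋖ q-covers
  ... | p⋖q@(s , _) = s , rotation-ascent σ , λ t t-ascent →
      toℕ-injective (≤-antisym (≮⇒≥ (λ s<t → no-ascent-after t s<t t-ascent))
                               (≮⇒≥ (λ t<s → no-ascent-before t t<s t-ascent)))
    where
    σ : Rotation u s (proj₁ q)
    σ = step-rotation p q p⋖q

    below-rotation : ∀ {t} (t-ascent : Ascent u t) →
      ¬ ¬ (Σ[ c ∈ Dyck m n ] Rotation u s (proj₁ c) × RotLe m n c (rotateDyck p t-ascent))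
    below-rotation {t} t-ascent =
      ¬¬-map (λ { (c , c-covers , c≤r) → c , subst (Rotation u s) (sym (q-unique c c-covers)) σ , c≤r })
             (cover-below (rot⋖⇒rotLt (t , rotAt (rotate-rotation {u = u} t-ascent))))

    s∈prim : ∀ {t} → Ascent u t → InPrim m u t s
    s∈prim {t} t-ascent = decidable-stable (inPrim? u t s)
      (¬¬-map (λ { (c , σ′ , c≤r) → rotation-above⇒inPrim σ′ (rotate-rotation t-ascent) c≤r })
              (below-rotation t-ascent))

    no-ascent-after : ∀ k → toℕ s < toℕ k → ¬ Ascent u k
    no-ascent-after k s<k k-ascent = <⇒≱ s<k (proj₁ (s∈prim k-ascent))

    no-ascent-before : ∀ k → toℕ k < toℕ s → ¬ Ascent u k
    no-ascent-before k k<s k-ascent with greatest-below (ascent? u) (toℕ s) k<s k-ascent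
    ... | t , t<s , t-ascent , no-ascent-between = below-rotation t-ascent λ { (c , σ′ , c≤r) →
      rotation-at-last-ascent-not-below m>0 mono no-ascent-after t<s (s∈prim t-ascent) no-ascent-between
        σ′ (rotate-rotation t-ascent) c≤r }

  twoValued⇒uniqueAscent : ∀ u {i a} → 1 ≤ i → i < n → 1 ≤ a → IsTwoValued u i a → UniqueAscent u
  twoValued⇒uniqueAscent u {suc i} _ i+1<n 0<a two = jump , jump-ascent , unique
    where
    jump last-zero : Fin n
    jump = fromℕ< i+1<n
    last-zero = fromℕ< (<-trans (n<1+n i) i+1<n)

    jump-ascent : Ascent u jump
    jump-ascent = last-zero , trans (cong suc (toℕ-fromℕ< _)) (sym (toℕ-fromℕ< i+1<n)) ,
      subst₂ _<_ (sym (proj₁ (two last-zero) (≤-reflexive (cong suc (toℕ-fromℕ< _)))))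
                 (sym (proj₂ (two jump) (≤-reflexive (sym (toℕ-fromℕ< i+1<n))))) 0<a

    unique : ∀ t → Ascent u t → t ≡ jump
    unique t (h , h+1≡t , u[h]<u[t]) with <-cmp (toℕ t) (suc i)
    ... | tri< t<i+1 _ _ = ⊥-elim (n≮0 (subst (lookup u h <_) (proj₁ (two t) t<i+1) u[h]<u[t]))
    ... | tri≈ _ t≡i+1 _ = toℕ-injective (trans t≡i+1 (sym (toℕ-fromℕ< i+1<n)))
    ... | tri> _ _ i+1<t =
      ⊥-elim (<-irrefl (trans (proj₂ (two h) i+1≤h) (sym (proj₂ (two t) (<⇒≤ i+1<t)))) u[h]<u[t])
      where
      i+1≤h : suc i ≤ toℕ h
      i+1≤h = s≤s⁻¹ (subst (suc (suc i) ≤_) (sym h+1≡t) i+1<t)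

  uniqueAscent⇒twoValued : (p : Dyck m n) → UniqueAscent (proj₁ p) →
    ∃[ i ] ∃[ a ] (1 ≤ i × i < n × 1 ≤ a × a ≤ m * i × IsTwoValued (proj₁ p) i a)
  uniqueAscent⇒twoValued (u , mono , bounded) (s , (h , h+1≡s , u[h]<u[s]) , unique) =
    toℕ s , lookup u s , subst (1 ≤_) h+1≡s (s≤s z≤n) , toℕ<n s , ≤-<-trans z≤n u[h]<u[s] , bounded s ,
    λ k → before-s k , after-s k
    where
    no-other-ascent : ∀ k → toℕ k ≢ toℕ s → ¬ Ascent u k
    no-other-ascent k k≢s k-ascent = k≢s (cong toℕ (unique k k-ascent))

    after-s : ∀ k → toℕ s ≤ toℕ k → lookup u k ≡ lookup u s
    after-s k s≤k = noAscent⇒flat {u = u} mono s≤k λ l s<l _ → no-other-ascent l (>⇒≢ s<l)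

    before-s : ∀ k → toℕ k < toℕ s → lookup u k ≡ 0
    before-s k k<s = trans (noAscent⇒flat {u = u} mono (subst (_≤ toℕ k) (sym first≡0) z≤n)
                                             λ l _ l≤k → no-other-ascent l (<⇒≢ (≤-<-trans l≤k k<s)))
                           (n≤0⇒n≡0 (subst (lookup u first ≤_) (trans (cong (m *_) first≡0) (*-zeroʳ m))
                                           (bounded first)))
      where
      first : Fin n
      first = fromℕ< (≤-<-trans z≤n (toℕ<n k))
      first≡0 : toℕ first ≡ 0
      first≡0 = toℕ-fromℕ< _

proposition3p4 : (m n : ℕ) → 0 < m → 0 < n → (p : Dyck m n) →
    MeetIrreducible m n p ⇔
      (∃[ i ] ∃[ a ] (1 ≤ i × i < n × 1 ≤ a × a ≤ m * i × IsTwoValued (proj₁ p) i a))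
proposition3p4 m n m>0 _ p =
  mk⇔ (uniqueAscent⇒twoValued m p ∘ meetIrreducible⇒uniqueAscent m m>0 p)
      (λ { (_ , _ , 1≤i , i<n , 1≤a , _ , two) →
           uniqueAscent⇒meetIrreducible m p (twoValued⇒uniqueAscent m (proj₁ p) 1≤i i<n 1≤a two) })
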